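{- For every $n\ge0$ there is a bijection between the set of palindromic oscillating tableaux of length $2n$ and height at most $1$ and the set of palindromic vacillating tableaux of length $2n$ and height at most $1$. Moreover, both sets have cardinality $\binom{n}{\lfloor n/2\rfloor}$.
   Context: Young diagrams of height at most $1$ are single rows, identified with nonnegative integers (number of squares). An oscillating tableau of length $m$ is a sequence $(\emptyset=\mu^0,\mu^1,\dots,\mu^m)$ of Young diagrams such that for each $1\le i\le m$, $\mu^i$ is obtained from $\mu^{i-1}$ by adding or removing one square. A vacillating tableau of length $2n$ is a sequence $\emptyset=\nu^0,\nu^1,\dots,\nu^{2n}=\emptyset$ of Young diagrams such that $\nu^{2i+1}$ equals $\nu^{2i}$ or is obtained from it by deleting a square, and $\nu^{2i}$ equals $\nu^{2i-1}$ or is obtained from it by adding a square. A tableau has height at most $1$ if all its diagrams have at most one row. A sequence $(\tau^0,\dots,\tau^{2n})$ is palindromic if $\tau^i=\tau^{2n-i}$ for all $i$. -}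

module Defs where

open import Data.Nat using (ℕ; zero; suc; _*_)
open import Data.Vec using (Vec; []; _∷_; head; last; reverse)
open import Data.Sum using (_⊎_)
open import Data.Product using (Σ; _×_)
open import Relation.Binary.PropositionalEquality using (_≡_)

-- A Young diagram of height at most 1 is a single row, identified with
-- its number of squares (a natural number).  A tableau (μ⁰,…,μᵐ) of height
-- at most 1 is therefore a vector of m+1 naturals.

AddOrRemove : ℕ → ℕ → Set
AddOrRemove μ μ' = μ' ≡ suc μ ⊎ μ ≡ suc μ'

StayOrDelete : ℕ → ℕ → Set
StayOrDelete ν ν' = ν' ≡ ν ⊎ ν ≡ suc ν'

StayOrAdd : ℕ → ℕ → Set
StayOrAdd ν ν' = ν' ≡ ν ⊎ ν' ≡ suc ν

data OscSteps : ∀ {k} → Vec ℕ k → Set where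
  one  : ∀ {x} → OscSteps (x ∷ [])
  step : ∀ {k x y} {xs : Vec ℕ k} →
         AddOrRemove x y → OscSteps (y ∷ xs) → OscSteps (x ∷ y ∷ xs)

-- alternating steps: from an even index (ν^{2i} → ν^{2i+1}) stay-or-delete,
-- from an odd index (ν^{2i-1} → ν^{2i}) stay-or-add.
mutual
  data VacStepsEven : ∀ {k} → Vec ℕ k → Set where
    one  : ∀ {x} → VacStepsEven (x ∷ [])
    step : ∀ {k x y} {xs : Vec ℕ k} →
           StayOrDelete x y → VacStepsOdd (y ∷ xs) → VacStepsEven (x ∷ y ∷ xs)

  data VacStepsOdd : ∀ {k} → Vec ℕ k → Set where
    step : ∀ {k x y} {xs : Vec ℕ k} →
           StayOrAdd x y → VacStepsEven (y ∷ xs) → VacStepsOdd (x ∷ y ∷ xs)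

IsOscillating : ∀ {m} → Vec ℕ (suc m) → Set
IsOscillating μ = head μ ≡ 0 × OscSteps μ

IsVacillating : ∀ {n} → Vec ℕ (suc (2 * n)) → Set
IsVacillating ν = head ν ≡ 0 × last ν ≡ 0 × VacStepsEven ν

Palindromic : ∀ {k} → Vec ℕ k → Set
Palindromic τ = reverse τ ≡ τ

PalOsc : ℕ → Set
PalOsc n = Σ (Vec ℕ (suc (2 * n))) (λ τ → IsOscillating τ × Palindromic τ)

PalVac : ℕ → Set
PalVac n = Σ (Vec ℕ (suc (2 * n))) (λ τ → IsVacillating {n} τ × Palindromic τ)

-- A palindromic tableau of length 2n is determined by its first half: reversing a step
-- μ → μ′ of an oscillating tableau gives again such a step, and reversing a StayOrDelete
-- step gives a StayOrAdd step, so the second half of a palindrome is automatically legal.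
-- Hence palindromic tableaux of length 2n correspond to walks of n steps from 0.  Recording
-- a vacillating walk ν at even positions as 2ν and at odd positions as 2ν + 1 turns it
-- into an oscillating walk, and every oscillating walk from 0 arises so, since its
-- parity alternates.  The number w(n, h) of oscillating walks of n steps from height h
-- satisfies w(n+1, 0) = w(n, 1) and w(n+1, h+1) = w(n, h+2) + w(n, h); Pascal's rule shows
-- that the window sum Σ_{j ≤ h} C(n, ⌊(n+h)/2⌋ − j) satisfies the same recursion, and at
-- h = 0 it is C(n, ⌊n/2⌋).

module Submission where

open import Defs
open import Data.Nat using (ℕ; zero; suc; _+_; _*_; _/_; _≤_; z≤n; s≤s; ⌊_/2⌋)
open import Data.Nat.Properties
  using (+-comm; +-assoc; +-suc; +-identityʳ; suc-injective; ⌊n/2⌋≤n; 1+n≢n; m≢1+n+m; +-commutativeSemigroup)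
open import Data.Nat.Combinatorics using (_C_; nCk+nC[k+1]≡[n+1]C[k+1])
open import Data.Nat.DivMod using (m/n≡1+[m∸n]/n)
open import Algebra.Properties.CommutativeSemigroup +-commutativeSemigroup
  using (interchange; x∙yz≈xz∙y; xy∙z≈xz∙y)
open import Data.Bool using (Bool; true; false; not)
open import Data.Empty using (⊥-elim)
open import Data.Fin using (Fin)
open import Data.Fin.Properties using (1↔⊤; +↔⊎)
open import Data.Product using (Σ; _×_; _,_; proj₁; proj₂)
open import Data.Product.Function.Dependent.Propositional using (Σ-↔)
open import Data.Sum using (_⊎_; inj₁; inj₂)
open import Data.Sum.Function.Propositional using (_⊎-↔_)
open import Data.Unit using (⊤; tt)
open import Data.Vec using (Vec; []; _∷_; head; last; reverse; _∷ʳ_; initLast)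
open import Data.Vec.Properties using (reverse-∷; ∷-injectiveˡ; ∷-injectiveʳ; ∷ʳ-injectiveˡ; last-reverse)
open import Function.Base using (_∘_)
open import Function.Bundles using (_↔_; mk↔ₛ′)
open import Function.Properties.Inverse using (↔-refl; ↔-sym; ↔-trans)
open import Relation.Nullary using (¬_)
open import Relation.Nullary.Irrelevant using (Irrelevant)
open import Axiom.UniquenessOfIdentityProofs.WithK using (uip)
open import Relation.Binary.PropositionalEquality

-- Walks and binomial window sums

walkCount : ℕ → ℕ → ℕ
walkCount zero    h       = 1
walkCount (suc n) zero    = walkCount n 1
walkCount (suc n) (suc h) = walkCount n (suc (suc h)) + walkCount n h

-- windowSum n k h = C(n, k) + C(n, k − 1) + ⋯ + C(n, k − h), stopping at C(n, 0) when h > k;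
-- nextTerm n k h is the summand C(n, k − h − 1) that widening the window adds (0 when h ≥ k).
windowSum : ℕ → ℕ → ℕ → ℕ
windowSum n k       zero    = n C k
windowSum n zero    (suc h) = n C 0
windowSum n (suc k) (suc h) = n C suc k + windowSum n k h

nextTerm : ℕ → ℕ → ℕ → ℕ
nextTerm n zero    h       = 0
nextTerm n (suc k) zero    = n C k
nextTerm n (suc k) (suc h) = nextTerm n k h

pascal : ∀ n k → suc n C suc k ≡ n C suc k + n C k
pascal n k = trans (sym (nCk+nC[k+1]≡[n+1]C[k+1] n k)) (+-comm (n C k) _)

windowSum-zero : ∀ n h → windowSum n 0 h ≡ 1
windowSum-zero n zero    = refl
windowSum-zero n (suc h) = refl

windowSum-suc : ∀ n k h → windowSum n k (suc h) ≡ windowSum n k h + nextTerm n k h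
windowSum-suc n zero    h       = trans (windowSum-zero n (suc h)) (cong (_+ 0) (sym (windowSum-zero n h)))
windowSum-suc n (suc k) zero    = refl
windowSum-suc n (suc k) (suc h) = trans (cong (n C suc k +_) (windowSum-suc n k h))
                                           (sym (+-assoc (n C suc k) (windowSum n k h) (nextTerm n k h)))

windowSum-pascal : ∀ n k h → windowSum (suc n) (suc k) h ≡ windowSum n (suc k) h + windowSum n k h
windowSum-pascal n k       zero    = pascal n k
windowSum-pascal n zero    (suc h) = begin
  suc n C 1 + windowSum (suc n) 0 h
    ≡⟨ cong₂ _+_ (pascal n 0) (trans (windowSum-zero (suc n) h) (sym (windowSum-zero n h))) ⟩
  n C 1 + n C 0 + windowSum n 0 h    ≡⟨ xy∙z≈xz∙y (n C 1) (n C 0) (windowSum n 0 h) ⟩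
  n C 1 + windowSum n 0 h + n C 0    ∎
  where open ≡-Reasoning
windowSum-pascal n (suc k) (suc h) = begin
  suc n C suc (suc k) + windowSum (suc n) (suc k) h
    ≡⟨ cong₂ _+_ (pascal n (suc k)) (windowSum-pascal n k h) ⟩
  (n C suc (suc k) + n C suc k) + (windowSum n (suc k) h + windowSum n k h)
    ≡⟨ interchange (n C suc (suc k)) (n C suc k) (windowSum n (suc k) h) (windowSum n k h) ⟩
  (n C suc (suc k) + windowSum n (suc k) h) + (n C suc k + windowSum n k h) ∎
  where open ≡-Reasoning

windowSum-recurrence : ∀ n k h →
  windowSum (suc n) (suc k) (suc h) ≡ windowSum n (suc k) (suc (suc h)) + windowSum n k h
windowSum-recurrence n k h = begin
  windowSum (suc n) (suc k) (suc h)
    ≡⟨ windowSum-pascal n k (suc h) ⟩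
  windowSum n (suc k) (suc h) + windowSum n k (suc h)
    ≡⟨ cong (windowSum n (suc k) (suc h) +_) (windowSum-suc n k h) ⟩
  windowSum n (suc k) (suc h) + (windowSum n k h + nextTerm n k h)
    ≡⟨ x∙yz≈xz∙y (windowSum n (suc k) (suc h)) (windowSum n k h) (nextTerm n k h) ⟩
  windowSum n (suc k) (suc h) + nextTerm n k h + windowSum n k h
    ≡⟨ cong (_+ windowSum n k h) (windowSum-suc n (suc k) (suc h)) ⟨
  windowSum n (suc k) (suc (suc h)) + windowSum n k h ∎
  where open ≡-Reasoning

windowSum-one : ∀ n k → windowSum n k 1 ≡ windowSum (suc n) k 0
windowSum-one n zero    = refl
windowSum-one n (suc k) = sym (pascal n k)

windowSum-empty : ∀ {k h} → k ≤ h → windowSum 0 k h ≡ 1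
windowSum-empty {zero}  {h}     _         = windowSum-zero 0 h
windowSum-empty {suc k} {suc h} (s≤s k≤h) = windowSum-empty k≤h

walkCount≡windowSum : ∀ n h → walkCount n h ≡ windowSum n ⌊ n + h /2⌋ h
walkCount≡windowSum zero    h       = sym (windowSum-empty (⌊n/2⌋≤n h))
walkCount≡windowSum (suc n) zero
  rewrite walkCount≡windowSum n 1 | +-comm n 1 | +-identityʳ n = windowSum-one n ⌊ suc n /2⌋
walkCount≡windowSum (suc n) (suc h)
  rewrite walkCount≡windowSum n (suc (suc h)) | walkCount≡windowSum n h
        | +-suc n (suc h) | +-suc n h = sym (windowSum-recurrence n ⌊ n + h /2⌋ h)

n/2≡⌊n/2⌋ : ∀ n → n / 2 ≡ ⌊ n /2⌋
n/2≡⌊n/2⌋ zero          = refl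
n/2≡⌊n/2⌋ (suc zero)    = refl
n/2≡⌊n/2⌋ (suc (suc n)) = trans (m/n≡1+[m∸n]/n {suc (suc n)} {2} (s≤s (s≤s z≤n))) (cong suc (n/2≡⌊n/2⌋ n))

walkCount-fromZero : ∀ n → walkCount n 0 ≡ n C (n / 2)
walkCount-fromZero n = begin
  walkCount n 0                 ≡⟨ walkCount≡windowSum n 0 ⟩
  n C ⌊ n + 0 /2⌋               ≡⟨ cong (λ m → n C ⌊ m /2⌋) (+-identityʳ n) ⟩
  n C ⌊ n /2⌋                   ≡⟨ cong (n C_) (sym (n/2≡⌊n/2⌋ n)) ⟩
  n C (n / 2)                   ∎
  where open ≡-Reasoning

×-irrelevant : ∀ {A B : Set} → Irrelevant A → Irrelevant B → Irrelevant (A × B)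
×-irrelevant irrA irrB (a , b) (a′ , b′) = cong₂ _,_ (irrA a a′) (irrB b b′)

⊎-irrelevant : ∀ {A B : Set} → Irrelevant A → Irrelevant B → (A → ¬ B) → Irrelevant (A ⊎ B)
⊎-irrelevant irrA irrB disjoint (inj₁ a) (inj₁ a′) = cong inj₁ (irrA a a′)
⊎-irrelevant irrA irrB disjoint (inj₂ b) (inj₂ b′) = cong inj₂ (irrB b b′)
⊎-irrelevant irrA irrB disjoint (inj₁ a) (inj₂ b)  = ⊥-elim (disjoint a b)
⊎-irrelevant irrA irrB disjoint (inj₂ b) (inj₁ a)  = ⊥-elim (disjoint a b)

↔-irrelevant : ∀ {A B : Set} → Irrelevant A → Irrelevant B → (A → B) → (B → A) → A ↔ B
↔-irrelevant irrA irrB f g = mk↔ₛ′ f g (λ _ → irrB _ _) (λ _ → irrA _ _)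

subst-↔ : ∀ {A : Set} (F : A → Set) {a b} → a ≡ b → F a ↔ F b
subst-↔ F refl = ↔-refl

module _ {A : Set} {X Q : A → Set} (Q-irrelevant : ∀ {y} → Irrelevant (Q y)) where

  Σ-onePoint : ∀ {a} → Q a → (∀ {y} → Q y → y ≡ a) → Σ A (λ y → Q y × X y) ↔ X a
  Σ-onePoint {a} qa only = mk↔ₛ′ to (λ t → a , qa , t) to-from from-to
    where
      to : Σ A (λ y → Q y × X y) → X a
      to (y , q , t) = subst X (only q) t
      to-from : ∀ t → to (a , qa , t) ≡ t
      to-from t = cong (λ e → subst X e t) (uip (only qa) refl)
      from-to : ∀ s → (a , qa , to s) ≡ s
      from-to (y , q , t) with refl ← only q = cong (λ q′ → a , q′ , t) (Q-irrelevant qa q)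

  Σ-twoPoint : ∀ {a b} → a ≢ b → Q a → Q b → (∀ {y} → Q y → y ≡ a ⊎ y ≡ b) →
               Σ A (λ y → Q y × X y) ↔ (X a ⊎ X b)
  Σ-twoPoint {a} {b} a≢b qa qb which = mk↔ₛ′ to from to-from from-to
    where
      to : Σ A (λ y → Q y × X y) → X a ⊎ X b
      to (y , q , t) with which q
      ... | inj₁ refl = inj₁ t
      ... | inj₂ refl = inj₂ t
      from : X a ⊎ X b → Σ A (λ y → Q y × X y)
      from (inj₁ t) = a , qa , t
      from (inj₂ t) = b , qb , t
      to-from : ∀ t → to (from t) ≡ t
      to-from (inj₁ t) with which qa
      ... | inj₁ refl = refl
      ... | inj₂ a≡b  = ⊥-elim (a≢b a≡b)
      to-from (inj₂ t) with which qb
      ... | inj₁ b≡a  = ⊥-elim (a≢b (sym b≡a))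
      ... | inj₂ refl = refl
      from-to : ∀ s → from (to s) ≡ s
      from-to (y , q , t) with which q
      ... | inj₁ refl = cong (λ q′ → a , q′ , t) (Q-irrelevant qa q)
      ... | inj₂ refl = cong (λ q′ → b , q′ , t) (Q-irrelevant qb q)

-- Palindromic alternating chains

double : ℕ → ℕ
double zero    = zero
double (suc n) = suc (suc (double n))

reverse-∷ʳ : ∀ {A : Set} {k} (xs : Vec A k) x → reverse (xs ∷ʳ x) ≡ x ∷ reverse xs
reverse-∷ʳ []       x = refl
reverse-∷ʳ (y ∷ ys) x = begin
  reverse ((y ∷ ys) ∷ʳ x)   ≡⟨ reverse-∷ y (ys ∷ʳ x) ⟩
  reverse (ys ∷ʳ x) ∷ʳ y    ≡⟨ cong (_∷ʳ y) (reverse-∷ʳ ys x) ⟩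
  x ∷ (reverse ys ∷ʳ y)     ≡⟨ cong (x ∷_) (reverse-∷ y ys) ⟨
  x ∷ reverse (y ∷ ys)      ∎
  where open ≡-Reasoning

Palindromic-last≡head : ∀ {k} (τ : Vec ℕ (suc k)) → Palindromic τ → last τ ≡ head τ
Palindromic-last≡head τ pal = trans (cong last (sym pal)) (last-reverse τ)

module _ {k} {x y} {zs : Vec ℕ k} (pal : Palindromic (x ∷ (zs ∷ʳ y))) where

  private
    reversed : y ∷ (reverse zs ∷ʳ x) ≡ x ∷ (zs ∷ʳ y)
    reversed = trans (sym (trans (reverse-∷ x (zs ∷ʳ y)) (cong (_∷ʳ x) (reverse-∷ʳ zs y)))) pal

  Palindromic-ends : y ≡ x
  Palindromic-ends = ∷-injectiveˡ reversed

  Palindromic-inner : Palindromic zs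
  Palindromic-inner = ∷ʳ-injectiveˡ _ _ (∷-injectiveʳ reversed)

Palindromic-wrap : ∀ {k} x {zs : Vec ℕ k} → Palindromic zs → Palindromic (x ∷ (zs ∷ʳ x))
Palindromic-wrap x {zs} pal = trans (reverse-∷ x (zs ∷ʳ x))
  (trans (cong (_∷ʳ x) (reverse-∷ʳ zs x)) (cong (λ us → x ∷ (us ∷ʳ x)) pal))

module PalindromicChains (R : Bool → ℕ → ℕ → Set) (R-irrelevant : ∀ b x y → Irrelevant (R b x y)) where

  data Chain : Bool → ∀ {k} → Vec ℕ (suc k) → Set where
    one  : ∀ {b x} → Chain b (x ∷ [])
    step : ∀ {b k x y} {xs : Vec ℕ k} → R b x y → Chain (not b) (y ∷ xs) → Chain b (x ∷ y ∷ xs)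

  Chain-irrelevant : ∀ {b k} {τ : Vec ℕ (suc k)} → Irrelevant (Chain b τ)
  Chain-irrelevant one        one          = refl
  Chain-irrelevant (step r c) (step r′ c′) = cong₂ step (R-irrelevant _ _ _ r r′) (Chain-irrelevant c c′)

  -- Two steps at a time, splitting on b, since not (not b) is not definitionally b.
  Chain-∷ʳ⁻ : ∀ m {b y} (τ : Vec ℕ (suc (double m))) → Chain b (τ ∷ʳ y) → Chain b τ × R b (last τ) y
  Chain-∷ʳ⁻ zero          (z ∷ [])         (step r one)          = one , r
  Chain-∷ʳ⁻ (suc m) {false} (z₁ ∷ z₂ ∷ z₃ ∷ zs) (step r₁ (step r₂ c)) with Chain-∷ʳ⁻ m (z₃ ∷ zs) c
  ... | c′ , r = step r₁ (step r₂ c′) , r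
  Chain-∷ʳ⁻ (suc m) {true}  (z₁ ∷ z₂ ∷ z₃ ∷ zs) (step r₁ (step r₂ c)) with Chain-∷ʳ⁻ m (z₃ ∷ zs) c
  ... | c′ , r = step r₁ (step r₂ c′) , r

  Chain-∷ʳ⁺ : ∀ m {b y} (τ : Vec ℕ (suc (double m))) → Chain b τ → R b (last τ) y → Chain b (τ ∷ʳ y)
  Chain-∷ʳ⁺ zero          (z ∷ [])         one                   r = step r one
  Chain-∷ʳ⁺ (suc m) {false} (z₁ ∷ z₂ ∷ z₃ ∷ zs) (step r₁ (step r₂ c)) r =
    step r₁ (step r₂ (Chain-∷ʳ⁺ m (z₃ ∷ zs) c r))
  Chain-∷ʳ⁺ (suc m) {true}  (z₁ ∷ z₂ ∷ z₃ ∷ zs) (step r₁ (step r₂ c)) r =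
    step r₁ (step r₂ (Chain-∷ʳ⁺ m (z₃ ∷ zs) c r))

  Chain-wrap : ∀ n {b h} (τ : Vec ℕ (suc (double n))) →
               R b h (head τ) → Chain (not b) τ → R (not b) (last τ) h → Chain b (h ∷ (τ ∷ʳ h))
  Chain-wrap n (z ∷ zs) r₁ c r₂ = step r₁ (Chain-∷ʳ⁺ n (z ∷ zs) c r₂)

  Chain-unwrap : ∀ n {b x y} (τ : Vec ℕ (suc (double n))) →
                 Chain b (x ∷ (τ ∷ʳ y)) → R b x (head τ) × Chain (not b) τ × R (not b) (last τ) y
  Chain-unwrap n (z ∷ zs) (step r₁ c) = r₁ , Chain-∷ʳ⁻ n (z ∷ zs) c

  PalChain : ℕ → Bool → ℕ → Set
  PalChain n b h = Σ (Vec ℕ (suc (double n))) (λ τ → (head τ ≡ h × Chain b τ) × Palindromic τ)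

  PalChain-≡ : ∀ {n b h} {σ τ : PalChain n b h} → proj₁ σ ≡ proj₁ τ → σ ≡ τ
  PalChain-≡ {σ = τ , p} {.τ , q} refl =
    cong (τ ,_) (×-irrelevant (×-irrelevant uip Chain-irrelevant) uip p q)

  -- The first half of a palindromic chain, read from the outside in: each layer is a step
  -- out of h together with its mirror image, the step back into h.
  HalfChain : Bool → ℕ → ℕ → Set
  HalfChain b zero    h = ⊤
  HalfChain b (suc n) h = Σ ℕ (λ y → (R b h y × R (not b) y h) × HalfChain (not b) n y)

  wrap : ∀ {n b h y} → R b h y → R (not b) y h → PalChain n (not b) y → PalChain (suc n) b h
  wrap {n} {b} {h} r₁ r₂ (τ , (τ₀≡y , c) , pal) =
    h ∷ (τ ∷ʳ h) ,
    (refl , Chain-wrap n τ (subst (R b h) (sym τ₀≡y) r₁) c (subst (λ u → R (not b) u h) (sym τ∞≡y) r₂)) ,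
    Palindromic-wrap h pal
    where
      τ∞≡y : last τ ≡ _
      τ∞≡y = trans (Palindromic-last≡head τ pal) τ₀≡y

  unwrap : ∀ n {b h x y} (τ : Vec ℕ (suc (double n))) →
           x ≡ h → Chain b (x ∷ (τ ∷ʳ y)) → Palindromic (x ∷ (τ ∷ʳ y)) →
           (R b h (head τ) × R (not b) (head τ) h) × PalChain n (not b) (head τ)
  unwrap n {b} τ x≡h c pal =
    let r₁ , c′ , r₂ = Chain-unwrap n τ c
        inner = Palindromic-inner pal
    in (subst (λ u → R b u (head τ)) x≡h r₁ ,
        subst₂ (R (not b)) (Palindromic-last≡head τ inner) (trans (Palindromic-ends pal) x≡h) r₂) ,
       (τ , (refl , c′) , inner)

  unfold : ∀ n b h → HalfChain b n h → PalChain n b h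
  unfold zero    b h tt                  = h ∷ [] , (refl , one) , refl
  unfold (suc n) b h (y , (r₁ , r₂) , t) = wrap r₁ r₂ (unfold n (not b) y t)

  fold : ∀ n b h → PalChain n b h → HalfChain b n h
  fold zero    b h _ = tt
  fold (suc n) b h (x ∷ ys , (x≡h , c) , pal) with initLast ys
  ... | τ , y , refl = let rs , σ = unwrap n τ x≡h c pal in head τ , rs , fold n (not b) (head τ) σ

  unfold-head : ∀ n b h (t : HalfChain b n h) → head (proj₁ (unfold n b h t)) ≡ h
  unfold-head n b h t = proj₁ (proj₁ (proj₂ (unfold n b h t)))

  unfold-injective : ∀ n b h (s t : HalfChain b n h) →
                     proj₁ (unfold n b h s) ≡ proj₁ (unfold n b h t) → s ≡ t
  unfold-injective zero    b h tt tt _ = refl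
  unfold-injective (suc n) b h (y , rs , s) (y′ , rs′ , t) eq
    with inner ← ∷ʳ-injectiveˡ _ _ (∷-injectiveʳ eq)
    with refl ← trans (sym (unfold-head n (not b) y s))
                      (trans (cong head inner) (unfold-head n (not b) y′ t))
    = cong₂ (λ rs s → y , rs , s) (×-irrelevant (R-irrelevant _ _ _) (R-irrelevant _ _ _) rs rs′)
                                  (unfold-injective n (not b) y s t inner)

  unfold-fold : ∀ n b h (σ : PalChain n b h) → unfold n b h (fold n b h σ) ≡ σ
  unfold-fold zero    b h (x ∷ [] , (x≡h , c) , pal) = PalChain-≡ (cong (_∷ []) (sym x≡h))
  unfold-fold (suc n) b h (x ∷ ys , (x≡h , c) , pal) with initLast ys
  ... | τ , y , refl = PalChain-≡ (begin
    h ∷ (proj₁ (unfold n (not b) (head τ) _) ∷ʳ h)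
      ≡⟨ cong (λ v → h ∷ (proj₁ v ∷ʳ h)) (unfold-fold n (not b) (head τ) _) ⟩
    h ∷ (τ ∷ʳ h)
      ≡⟨ cong₂ (λ u v → u ∷ (τ ∷ʳ v)) x≡h y≡h ⟨
    x ∷ (τ ∷ʳ y) ∎)
    where
      open ≡-Reasoning
      y≡h : y ≡ h
      y≡h = trans (Palindromic-ends pal) x≡h

  -- fold peels the last entry off with initLast, so fold ∘ unfold does not compute;
  -- that inverse law comes from the injectivity of unfold instead.
  PalChain↔HalfChain : ∀ n b h → PalChain n b h ↔ HalfChain b n h
  PalChain↔HalfChain n b h = mk↔ₛ′ (fold n b h) (unfold n b h)
    (λ t → unfold-injective n b h _ _ (cong proj₁ (unfold-fold n b h (unfold n b h t))))
    (unfold-fold n b h)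

-- Oscillating and vacillating walks

AddOrRemove-irrelevant : ∀ {x y} → Irrelevant (AddOrRemove x y)
AddOrRemove-irrelevant {x} = ⊎-irrelevant uip uip (λ { refl e → m≢1+n+m x {1} e })

StayOrDelete-irrelevant : ∀ {x y} → Irrelevant (StayOrDelete x y)
StayOrDelete-irrelevant = ⊎-irrelevant uip uip (λ { refl e → 1+n≢n (sym e) })

StayOrAdd-irrelevant : ∀ {x y} → Irrelevant (StayOrAdd x y)
StayOrAdd-irrelevant = ⊎-irrelevant uip uip (λ { refl e → 1+n≢n (sym e) })

vacStep : Bool → ℕ → ℕ → Set
vacStep false = StayOrDelete
vacStep true  = StayOrAdd

vacStep-irrelevant : ∀ b x y → Irrelevant (vacStep b x y)
vacStep-irrelevant false _ _ = StayOrDelete-irrelevant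
vacStep-irrelevant true  _ _ = StayOrAdd-irrelevant

module Osc = PalindromicChains (λ _ → AddOrRemove) (λ _ _ _ → AddOrRemove-irrelevant)
module Vac = PalindromicChains vacStep vacStep-irrelevant

AddOrRemove-there-and-back-from-0 : ∀ {y} → AddOrRemove 0 y × AddOrRemove y 0 → y ≡ 1
AddOrRemove-there-and-back-from-0 (inj₁ y≡1 , _) = y≡1
AddOrRemove-there-and-back-from-0 (inj₂ () , _)

AddOrRemove-there-and-back : ∀ {h y} → AddOrRemove (suc h) y × AddOrRemove y (suc h) → y ≡ suc (suc h) ⊎ y ≡ h
AddOrRemove-there-and-back (inj₁ up , _)   = inj₁ up
AddOrRemove-there-and-back (inj₂ down , _) = inj₂ (suc-injective (sym down))

StayOrDelete-there-and-back-from-0 : ∀ {y} → StayOrDelete 0 y × StayOrAdd y 0 → y ≡ 0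
StayOrDelete-there-and-back-from-0 (inj₁ stay , _) = stay
StayOrDelete-there-and-back-from-0 (inj₂ () , _)

StayOrDelete-there-and-back : ∀ {x y} → StayOrDelete (suc x) y × StayOrAdd y (suc x) → y ≡ suc x ⊎ y ≡ x
StayOrDelete-there-and-back (inj₁ stay , _)   = inj₁ stay
StayOrDelete-there-and-back (inj₂ down , _) = inj₂ (suc-injective (sym down))

StayOrAdd-there-and-back : ∀ {x y} → StayOrAdd x y × StayOrDelete y x → y ≡ suc x ⊎ y ≡ x
StayOrAdd-there-and-back (inj₁ stay , _) = inj₂ stay
StayOrAdd-there-and-back (inj₂ up , _)   = inj₁ up

Osc-HalfChain-at-0 : ∀ {n b} → Osc.HalfChain b (suc n) 0 ↔ Osc.HalfChain (not b) n 1
Osc-HalfChain-at-0 = Σ-onePoint (×-irrelevant AddOrRemove-irrelevant AddOrRemove-irrelevant)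
                                (inj₁ refl , inj₂ refl) AddOrRemove-there-and-back-from-0

Osc-HalfChain-at-suc : ∀ {n b} h →
  Osc.HalfChain b (suc n) (suc h) ↔ (Osc.HalfChain (not b) n (suc (suc h)) ⊎ Osc.HalfChain (not b) n h)
Osc-HalfChain-at-suc h = Σ-twoPoint (×-irrelevant AddOrRemove-irrelevant AddOrRemove-irrelevant)
                                    (m≢1+n+m h {1} ∘ sym) (inj₁ refl , inj₂ refl) (inj₂ refl , inj₁ refl)
                                    AddOrRemove-there-and-back

Vac-HalfChain-down-at-0 : ∀ {n} → Vac.HalfChain false (suc n) 0 ↔ Vac.HalfChain true n 0
Vac-HalfChain-down-at-0 = Σ-onePoint (×-irrelevant StayOrDelete-irrelevant StayOrAdd-irrelevant)
                                     (inj₁ refl , inj₁ refl) StayOrDelete-there-and-back-from-0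

Vac-HalfChain-down-at-suc : ∀ {n} x →
  Vac.HalfChain false (suc n) (suc x) ↔ (Vac.HalfChain true n (suc x) ⊎ Vac.HalfChain true n x)
Vac-HalfChain-down-at-suc x = Σ-twoPoint (×-irrelevant StayOrDelete-irrelevant StayOrAdd-irrelevant)
                                         1+n≢n (inj₁ refl , inj₁ refl) (inj₂ refl , inj₂ refl)
                                         StayOrDelete-there-and-back

Vac-HalfChain-up : ∀ {n} x →
  Vac.HalfChain true (suc n) x ↔ (Vac.HalfChain false n (suc x) ⊎ Vac.HalfChain false n x)
Vac-HalfChain-up x = Σ-twoPoint (×-irrelevant StayOrAdd-irrelevant StayOrDelete-irrelevant)
                                1+n≢n (inj₂ refl , inj₂ refl) (inj₁ refl , inj₁ refl)
                                StayOrAdd-there-and-back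

Osc-HalfChain↔walkCount : ∀ n b h → Osc.HalfChain b n h ↔ Fin (walkCount n h)
Osc-HalfChain↔walkCount zero    b h       = ↔-sym 1↔⊤
Osc-HalfChain↔walkCount (suc n) b zero    = ↔-trans Osc-HalfChain-at-0 (Osc-HalfChain↔walkCount n (not b) 1)
Osc-HalfChain↔walkCount (suc n) b (suc h) =
  ↔-trans (Osc-HalfChain-at-suc h)
  (↔-trans (Osc-HalfChain↔walkCount n (not b) (suc (suc h)) ⊎-↔ Osc-HalfChain↔walkCount n (not b) h)
           (↔-sym +↔⊎))

oscHeight : Bool → ℕ → ℕ
oscHeight false x = double x
oscHeight true  x = suc (double x)

Vac-HalfChain↔Osc-HalfChain : ∀ n b x → Vac.HalfChain b n x ↔ Osc.HalfChain b n (oscHeight b x)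
Vac-HalfChain↔Osc-HalfChain zero    b     x       = ↔-refl
Vac-HalfChain↔Osc-HalfChain (suc n) false zero    =
  ↔-trans Vac-HalfChain-down-at-0 (↔-trans (Vac-HalfChain↔Osc-HalfChain n true 0) (↔-sym Osc-HalfChain-at-0))
Vac-HalfChain↔Osc-HalfChain (suc n) false (suc x) =
  ↔-trans (Vac-HalfChain-down-at-suc x)
  (↔-trans (Vac-HalfChain↔Osc-HalfChain n true (suc x) ⊎-↔ Vac-HalfChain↔Osc-HalfChain n true x)
           (↔-sym (Osc-HalfChain-at-suc (suc (double x)))))
Vac-HalfChain↔Osc-HalfChain (suc n) true  x       =
  ↔-trans (Vac-HalfChain-up x)
  (↔-trans (Vac-HalfChain↔Osc-HalfChain n false (suc x) ⊎-↔ Vac-HalfChain↔Osc-HalfChain n false x)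
           (↔-sym (Osc-HalfChain-at-suc (double x))))

-- Tableaux as chains

2*n≡double : ∀ n → 2 * n ≡ double n
2*n≡double zero    = refl
2*n≡double (suc n) = cong suc (trans (+-suc n (n + 0)) (cong suc (2*n≡double n)))

OscSteps-irrelevant : ∀ {k} {τ : Vec ℕ k} → Irrelevant (OscSteps τ)
OscSteps-irrelevant one        one          = refl
OscSteps-irrelevant (step r c) (step r′ c′) = cong₂ step (AddOrRemove-irrelevant r r′) (OscSteps-irrelevant c c′)

OscSteps⇒Chain : ∀ {b k} {τ : Vec ℕ (suc k)} → OscSteps τ → Osc.Chain b τ
OscSteps⇒Chain one        = Osc.one
OscSteps⇒Chain (step r c) = Osc.step r (OscSteps⇒Chain c)

Chain⇒OscSteps : ∀ {b k} {τ : Vec ℕ (suc k)} → Osc.Chain b τ → OscSteps τ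
Chain⇒OscSteps Osc.one        = one
Chain⇒OscSteps (Osc.step r c) = step r (Chain⇒OscSteps c)

mutual
  VacStepsEven-irrelevant : ∀ {k} {τ : Vec ℕ k} → Irrelevant (VacStepsEven τ)
  VacStepsEven-irrelevant one        one          = refl
  VacStepsEven-irrelevant (step r c) (step r′ c′) =
    cong₂ step (StayOrDelete-irrelevant r r′) (VacStepsOdd-irrelevant c c′)

  VacStepsOdd-irrelevant : ∀ {k} {τ : Vec ℕ k} → Irrelevant (VacStepsOdd τ)
  VacStepsOdd-irrelevant (step r c) (step r′ c′) =
    cong₂ step (StayOrAdd-irrelevant r r′) (VacStepsEven-irrelevant c c′)

mutual
  VacStepsEven⇒Chain : ∀ {k} {τ : Vec ℕ (suc k)} → VacStepsEven τ → Vac.Chain false τ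
  VacStepsEven⇒Chain one        = Vac.one
  VacStepsEven⇒Chain (step r c) = Vac.step r (VacStepsOdd⇒Chain c)

  VacStepsOdd⇒Chain : ∀ {k} {τ : Vec ℕ (suc k)} → VacStepsOdd τ → Vac.Chain true τ
  VacStepsOdd⇒Chain (step r c) = Vac.step r (VacStepsEven⇒Chain c)

Chain⇒VacStepsEven : ∀ n {τ : Vec ℕ (suc (double n))} → Vac.Chain false τ → VacStepsEven τ
Chain⇒VacStepsEven zero    Vac.one                       = one
Chain⇒VacStepsEven (suc n) (Vac.step r₁ (Vac.step r₂ c)) = step r₁ (step r₂ (Chain⇒VacStepsEven n c))

PalOsc↔Osc-PalChain : ∀ n → PalOsc n ↔ Osc.PalChain n false 0
PalOsc↔Osc-PalChain n =
  ↔-trans (Σ-↔ ↔-refl (↔-irrelevant (×-irrelevant (×-irrelevant uip OscSteps-irrelevant) uip)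
                                    (×-irrelevant (×-irrelevant uip Osc.Chain-irrelevant) uip)
                                    (λ ((τ₀≡0 , c) , pal) → (τ₀≡0 , OscSteps⇒Chain c) , pal)
                                    (λ ((τ₀≡0 , c) , pal) → (τ₀≡0 , Chain⇒OscSteps c) , pal)))
          (subst-↔ (λ m → Σ (Vec ℕ (suc m)) (λ τ → (head τ ≡ 0 × Osc.Chain false τ) × Palindromic τ))
                   (2*n≡double n))

PalVac↔Vac-PalChain : ∀ n → PalVac n ↔ Vac.PalChain n false 0
PalVac↔Vac-PalChain n =
  ↔-trans (subst-↔ (λ m → Σ (Vec ℕ (suc m))
                              (λ τ → (head τ ≡ 0 × last τ ≡ 0 × VacStepsEven τ) × Palindromic τ))
                   (2*n≡double n))
          (Σ-↔ ↔-refl λ {τ} → ↔-irrelevant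
             (×-irrelevant (×-irrelevant uip (×-irrelevant uip VacStepsEven-irrelevant)) uip)
             (×-irrelevant (×-irrelevant uip Vac.Chain-irrelevant) uip)
             (λ ((τ₀≡0 , _ , c) , pal) → (τ₀≡0 , VacStepsEven⇒Chain c) , pal)
             (λ ((τ₀≡0 , c) , pal) →
               (τ₀≡0 , trans (Palindromic-last≡head τ pal) τ₀≡0 , Chain⇒VacStepsEven n c) , pal))

proposition14 : (n : ℕ) →
    (PalOsc n ↔ PalVac n) × (PalOsc n ↔ Fin (n C (n / 2))) × (PalVac n ↔ Fin (n C (n / 2)))
proposition14 n = ↔-trans osc (↔-sym vac) , ↔-trans osc count , ↔-trans vac count
  where
    osc : PalOsc n ↔ Osc.HalfChain false n 0
    osc = ↔-trans (PalOsc↔Osc-PalChain n) (Osc.PalChain↔HalfChain n false 0)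

    vac : PalVac n ↔ Osc.HalfChain false n 0
    vac = ↔-trans (PalVac↔Vac-PalChain n)
                  (↔-trans (Vac.PalChain↔HalfChain n false 0) (Vac-HalfChain↔Osc-HalfChain n false 0))

    count : Osc.HalfChain false n 0 ↔ Fin (n C (n / 2))
    count = ↔-trans (Osc-HalfChain↔walkCount n false 0) (subst-↔ Fin (walkCount-fromZero n))
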